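{- Let $a\equiv 1\pmod 4$ be a positive integer and $b$ an integer such that $\mathbb{Z}a+\mathbb{Z}(b+i)$ is an ideal of $\mathbb{Z}[i]$ (i.e. $a\mid b^2+1$). For parities $\epsilon,\eta\in\{0,1\}$ write $S(\epsilon,\eta)=\left\{\frac{|ua-v(b+i)|^2}{a}:\ u,v\in\mathbb{Z},\ u\equiv\epsilon,\ v\equiv\eta\pmod 2\right\}$ and $T(\epsilon,\eta)=\{x^2+y^2:\ x,y\in\mathbb{Z},\ x\equiv\epsilon,\ y\equiv\eta\pmod 2\}$. If $b$ is odd, then $S(0,0)=T(0,0)$, $S(1,0)=T(0,1)$, $S(0,1)=T(1,1)$, $S(1,1)=T(1,0)$. If $b$ is even, then $S(0,0)=T(0,0)$, $S(1,0)=T(0,1)$, $S(0,1)=T(1,0)$, $S(1,1)=T(1,1)$. -}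

module Defs where

open import Data.Integer using (ℤ; +_; _+_; _-_; _*_)
open import Data.Integer.Divisibility using (_∣_)
open import Data.Product using (∃-syntax; _×_)
open import Function.Bundles using (_⇔_)
open import Relation.Binary.PropositionalEquality using (_≡_)

_≡_[mod_] : ℤ → ℤ → ℤ → Set
x ≡ y [mod m ] = m ∣ (x - y)

-- Parities ε, η ∈ {0,1} are represented by integers 0 and 1 (+ 0, + 1).
-- |u a - v (b + i)|^2 = (u a - v b)^2 + v^2.
normS : ℤ → ℤ → ℤ → ℤ → ℤ
normS a b u v = (u * a - v * b) * (u * a - v * b) + v * v

S : ℤ → ℤ → ℤ → ℤ → ℤ → Set
S a b ε η n = ∃[ u ] ∃[ v ] (u ≡ ε [mod + 2 ] × v ≡ η [mod + 2 ] × a * n ≡ normS a b u v)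

T : ℤ → ℤ → ℤ → Set
T ε η n = ∃[ x ] ∃[ y ] (x ≡ ε [mod + 2 ] × y ≡ η [mod + 2 ] × n ≡ x * x + y * y)

_≐_ : (ℤ → Set) → (ℤ → Set) → Set
P ≐ Q = ∀ n → P n ⇔ Q n

{-# OPTIONS --safe #-}
-- Since a ∣ b² + 1, the ideal ℤa + ℤ(b + i) of ℤ[i] has index a and is generated by some
-- π = p + q i of norm a; such a π is found by descent on a, reducing b modulo a so that
-- b² + 1 = c a with 0 < c < a. As a is odd, exactly one of p, q is odd, and multiplying π by i
-- if necessary makes q the odd one. Dividing by π (up to conjugation) matches the points
-- u a - v (b + i) of the ideal with the Gaussian integers x + y i, dividing the norm by a.
-- Modulo 2 we have π ≡ i and a ≡ 1, so x ≡ v and y ≡ u + v b: this is the stated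
-- correspondence of parities.

module Submission where

open import Defs
open import Data.Integer using (ℤ; +_; _+_; _*_; _>_)
open import Data.Integer.Divisibility using (_∣_)
open import Data.Product using (_×_)
open import Relation.Nullary using (¬_)

open import Data.Integer.Base using (-_; _-_; _⊖_; -[1+_]; +[1+_]; ∣_∣; NonZero; ≢-nonZero; +<+)
import Data.Integer.Properties as ℤ
import Data.Integer.Divisibility.Signed as ℤ∣
import Data.Integer.DivMod as ℤ/
open import Data.Integer.Tactic.RingSolver using (solve; solve-∀)
open import Data.Nat.Base as ℕ using (ℕ; zero; suc)
import Data.Nat.Properties as ℕ
import Data.Nat.Divisibility as ℕ
open import Data.Nat.Induction using (<-rec)
open import Data.Parity.Base as ℙ using (Parity; 0ℙ; 1ℙ)
import Data.Parity.Properties as ℙ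
open import Data.Empty using (⊥-elim)
open import Data.List.Base using (_∷_; [])
open import Data.Product using (Σ; _,_; Σ-syntax; ∃-syntax)
open import Data.Sum using (_⊎_; inj₁; inj₂; [_,_]′)
open import Function.Bundles using (_⇔_; mk⇔; Equivalence)
open import Relation.Binary.PropositionalEquality
open ≡-Reasoning

p+q≡0ℙ⇔p≡q : ∀ {p q} → p ℙ.+ q ≡ 0ℙ ⇔ p ≡ q
p+q≡0ℙ⇔p≡q {p} = mk⇔ to (λ { refl → ℙ.p+p≡0ℙ p })
  where
  to : ∀ {p q} → p ℙ.+ q ≡ 0ℙ → p ≡ q
  to {0ℙ} {0ℙ} _ = refl
  to {1ℙ} {1ℙ} _ = refl

p+q+q≡p : ∀ p q → p ℙ.+ q ℙ.+ q ≡ p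
p+q+q≡p p q = begin
  p ℙ.+ q ℙ.+ q   ≡⟨ ℙ.+-assoc p q q ⟩
  p ℙ.+ (q ℙ.+ q) ≡⟨ cong (p ℙ.+_) (ℙ.p+p≡0ℙ q) ⟩
  p ℙ.+ 0ℙ        ≡⟨ ℙ.+-identityʳ p ⟩
  p               ∎

2∣⇔parity≡0ℙ : ∀ {n} → 2 ℕ.∣ n ⇔ ℕ.parity n ≡ 0ℙ
2∣⇔parity≡0ℙ = mk⇔ to from
  where
  to : ∀ {n} → 2 ℕ.∣ n → ℕ.parity n ≡ 0ℙ
  to (ℕ.divides k refl) = trans (ℙ.*-homo-* k 2) (ℙ.*-zeroʳ (ℕ.parity k))
  from : ∀ {n} → ℕ.parity n ≡ 0ℙ → 2 ℕ.∣ n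
  from {zero} _ = 2 ℕ.∣0
  from {suc (suc n)} even = ℕ.∣m∣n⇒∣m+n ℕ.∣-refl (from {n} even)

parity : ℤ → Parity
parity i = ℕ.parity ∣ i ∣

parity-neg : ∀ i → parity (- i) ≡ parity i
parity-neg i = cong ℕ.parity (ℤ.∣-i∣≡∣i∣ i)

parity-* : ∀ i j → parity (i * j) ≡ parity i ℙ.* parity j
parity-* i j = trans (cong ℕ.parity (ℤ.abs-* i j)) (ℙ.*-homo-* ∣ i ∣ ∣ j ∣)

parity[1+m]+parity[1+n] : ∀ m n → ℕ.parity (suc m) ℙ.+ ℕ.parity (suc n) ≡ ℕ.parity m ℙ.+ ℕ.parity n
parity[1+m]+parity[1+n] m n = begin
  ℕ.parity (suc m) ℙ.+ ℕ.parity (suc n) ≡⟨ ℙ.+-homo-+ (suc m) (suc n) ⟨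
  ℕ.parity (suc m ℕ.+ suc n)           ≡⟨ cong (λ k → ℕ.parity (suc k)) (ℕ.+-suc m n) ⟩
  ℕ.parity (m ℕ.+ n)                   ≡⟨ ℙ.+-homo-+ m n ⟩
  ℕ.parity m ℙ.+ ℕ.parity n            ∎

parity-⊖ : ∀ m n → parity (m ⊖ n) ≡ ℕ.parity m ℙ.+ ℕ.parity n
parity-⊖ m zero = trans (cong parity (ℤ.⊖-≥ {m} ℕ.z≤n)) (sym (ℙ.+-identityʳ (ℕ.parity m)))
parity-⊖ zero (suc n) = refl
parity-⊖ (suc m) (suc n) = begin
  parity (suc m ⊖ suc n)                 ≡⟨ cong parity (ℤ.[1+m]⊖[1+n]≡m⊖n m n) ⟩
  parity (m ⊖ n)                         ≡⟨ parity-⊖ m n ⟩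
  ℕ.parity m ℙ.+ ℕ.parity n              ≡⟨ parity[1+m]+parity[1+n] m n ⟨
  ℕ.parity (suc m) ℙ.+ ℕ.parity (suc n)  ∎

parity-+ : ∀ i j → parity (i + j) ≡ parity i ℙ.+ parity j
parity-+ (+ m) (+ n) = ℙ.+-homo-+ m n
parity-+ (+ m) -[1+ n ] = parity-⊖ m (suc n)
parity-+ -[1+ m ] (+ n) = trans (parity-⊖ n (suc m)) (ℙ.+-comm (ℕ.parity n) (ℕ.parity (suc m)))
parity-+ -[1+ m ] -[1+ n ] = trans (ℙ.+-homo-+ m n) (sym (parity[1+m]+parity[1+n] m n))

parity-- : ∀ i j → parity (i - j) ≡ parity i ℙ.+ parity j
parity-- i j = trans (parity-+ i (- j)) (cong (parity i ℙ.+_) (parity-neg j))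

≡[mod2]⇔parity≡ : ∀ i j → i ≡ j [mod + 2 ] ⇔ parity i ≡ parity j
≡[mod2]⇔parity≡ i j = mk⇔
  (λ 2∣i-j → Equivalence.to p+q≡0ℙ⇔p≡q (trans (sym (parity-- i j)) (Equivalence.to 2∣⇔parity≡0ℙ 2∣i-j)))
  (λ pi≡pj → Equivalence.from 2∣⇔parity≡0ℙ (trans (parity-- i j) (Equivalence.from p+q≡0ℙ⇔p≡q pi≡pj)))

¬2∣⇒parity≡1ℙ : ∀ i → ¬ (+ 2 ∣ i) → parity i ≡ 1ℙ
¬2∣⇒parity≡1ℙ i 2∤i with parity i in eq
... | 0ℙ = ⊥-elim (2∤i (Equivalence.from 2∣⇔parity≡0ℙ eq))
... | 1ℙ = refl

≡1[mod4]⇒parity≡1ℙ : ∀ a → a ≡ + 1 [mod + 4 ] → parity a ≡ 1ℙ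
≡1[mod4]⇒parity≡1ℙ a 4∣a-1 = Equivalence.to (≡[mod2]⇔parity≡ a (+ 1)) (ℕ.∣-trans (ℕ.divides 2 refl) 4∣a-1)

parity-*-odd : ∀ {j} → parity j ≡ 1ℙ → ∀ i → parity (i * j) ≡ parity i
parity-*-odd {j} j-odd i = begin
  parity (i * j)          ≡⟨ parity-* i j ⟩
  parity i ℙ.* parity j   ≡⟨ cong (parity i ℙ.*_) j-odd ⟩
  parity i ℙ.* 1ℙ         ≡⟨ ℙ.*-identityʳ (parity i) ⟩
  parity i                ∎

parity-sum-of-squares : ∀ x y → parity (x * x + y * y) ≡ parity x ℙ.+ parity y
parity-sum-of-squares x y = begin
  parity (x * x + y * y)                         ≡⟨ parity-+ (x * x) (y * y) ⟩
  parity (x * x) ℙ.+ parity (y * y)              ≡⟨ cong₂ ℙ._+_ (parity-* x x) (parity-* y y) ⟩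
  (parity x ℙ.* parity x) ℙ.+ (parity y ℙ.* parity y) ≡⟨ cong₂ ℙ._+_ (ℙ.*-idem (parity x)) (ℙ.*-idem (parity y)) ⟩
  parity x ℙ.+ parity y                          ∎

odd-sum-of-squares : ∀ x y → parity (x * x + y * y) ≡ 1ℙ →
  (parity x ≡ 0ℙ × parity y ≡ 1ℙ) ⊎ (parity x ≡ 1ℙ × parity y ≡ 0ℙ)
odd-sum-of-squares x y odd with parity x | parity y | trans (sym (parity-sum-of-squares x y)) odd
... | 0ℙ | 1ℙ | _ = inj₁ (refl , refl)
... | 1ℙ | 0ℙ | _ = inj₂ (refl , refl)
... | 0ℙ | 0ℙ | ()
... | 1ℙ | 1ℙ | ()

-- p + q i lies in the ideal ℤa + ℤ(b + i) of ℤ[i] and has norm a, so it generates that ideal.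
record Generator (a b : ℤ) : Set where
  field
    q t : ℤ

  p : ℤ
  p = b * q + t * a

  field
    norm : p * p + q * q ≡ a

generator-one : ∀ b → Generator (+ 1) b
generator-one b = record { q = + 0 ; t = + 1 ; norm = solve (b ∷ []) }

generator-shift : ∀ {a b} k → Generator a b → Generator a (b + k * a)
generator-shift {a} {b} k record { q = q ; t = t ; norm = norm } =
  record { q = q ; t = t - k * q ; norm = trans (cong (λ p → p * p + q * q) same-p) norm }
  where
  same-p : (b + k * a) * q + (t - k * q) * a ≡ b * q + t * a
  same-p = solve (a ∷ b ∷ k ∷ q ∷ t ∷ [])

generator-mul-i : ∀ {a b} → a ℤ∣.∣ b * b + + 1 → (G : Generator a b) →
  Σ[ G′ ∈ Generator a b ] (Generator.p G′ ≡ - Generator.q G × Generator.q G′ ≡ Generator.p G)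
generator-mul-i {a} {b} (ℤ∣.divides s b²+1≡sa) record { q = q ; t = t ; norm = norm } =
  record { q = b * q + t * a ; t = - (q * s + b * t) ; norm = norm′ } , i*p≡-q , refl
  where
  i*p≡-q : b * (b * q + t * a) + - (q * s + b * t) * a ≡ - q
  i*p≡-q = begin
    b * (b * q + t * a) + - (q * s + b * t) * a ≡⟨ solve (a ∷ b ∷ q ∷ s ∷ t ∷ []) ⟩
    q * (b * b + + 1) - q * (s * a) - q         ≡⟨ cong (λ m → q * m - q * (s * a) - q) b²+1≡sa ⟩
    q * (s * a) - q * (s * a) - q               ≡⟨ solve (a ∷ q ∷ s ∷ []) ⟩
    - q                                         ∎
  norm′ : (b * (b * q + t * a) + - (q * s + b * t) * a) * (b * (b * q + t * a) + - (q * s + b * t) * a)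
          + (b * q + t * a) * (b * q + t * a) ≡ a
  norm′ = begin
    _ ≡⟨ cong (λ p′ → p′ * p′ + (b * q + t * a) * (b * q + t * a)) i*p≡-q ⟩
    - q * - q + (b * q + t * a) * (b * q + t * a) ≡⟨ solve (a ∷ b ∷ q ∷ t ∷ []) ⟩
    (b * q + t * a) * (b * q + t * a) + q * q     ≡⟨ norm ⟩
    a                                             ∎

-- If π′ generates the ideal for c, then (b + i) π̄′ / c generates the one for a.
generator-descent : ∀ {a b c} .{{_ : NonZero c}} → b * b + + 1 ≡ c * a → Generator c b → Generator a b
generator-descent {a} {b} {c} b²+1≡ca record { q = q ; t = t ; norm = norm } =
  record { q = t ; t = q ; norm = ℤ.*-cancelˡ-≡ c _ _ (ℤ.*-cancelˡ-≡ c _ _ c²-scaled) }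
  where
  c²-scaled : c * (c * ((b * t + q * a) * (b * t + q * a) + t * t)) ≡ c * (c * a)
  c²-scaled = begin
    c * (c * ((b * t + q * a) * (b * t + q * a) + t * t))
      ≡⟨ solve (a ∷ b ∷ c ∷ q ∷ t ∷ []) ⟩
    (b * (t * c) + q * (c * a)) * (b * (t * c) + q * (c * a)) + (t * c) * (t * c)
      ≡⟨ cong (λ m → (b * (t * c) + q * m) * (b * (t * c) + q * m) + (t * c) * (t * c)) b²+1≡ca ⟨
    (b * (t * c) + q * (b * b + + 1)) * (b * (t * c) + q * (b * b + + 1)) + (t * c) * (t * c)
      ≡⟨ solve (b ∷ c ∷ q ∷ t ∷ []) ⟩
    ((b * q + t * c) * (b * q + t * c) + q * q) * (b * b + + 1)
      ≡⟨ cong₂ _*_ norm b²+1≡ca ⟩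
    c * (c * a) ∎

∣[x+ka]²+1⇒∣x²+1 : ∀ {a x} k → a ℤ∣.∣ (x + k * a) * (x + k * a) + + 1 → a ℤ∣.∣ x * x + + 1
∣[x+ka]²+1⇒∣x²+1 {a} {x} k a∣ = ℤ∣.∣m+n∣n⇒∣m (subst (a ℤ∣.∣_) expand a∣) (ℤ∣.∣n⇒∣m*n (k * (+ 2 * x + k * a)) ℤ∣.∣-refl)
  where
  expand : (x + k * a) * (x + k * a) + + 1 ≡ (x * x + + 1) + k * (+ 2 * x + k * a) * a
  expand = solve (a ∷ k ∷ x ∷ [])

cofactor≤ : ∀ {m r c} → 1 ℕ.≤ m → r ℕ.≤ m → r ℕ.* r ℕ.+ 1 ≡ c ℕ.* suc m → c ℕ.≤ m
cofactor≤ {m} {r} {c} 1≤m r≤m r²+1≡c[1+m] = ℕ.*-cancelʳ-≤ c m (suc m)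
  (subst (ℕ._≤ m ℕ.* suc m) r²+1≡c[1+m] (ℕ.≤-trans (ℕ.+-mono-≤ (ℕ.*-mono-≤ r≤m r≤m) 1≤m) (ℕ.≤-reflexive m²+m≡m[1+m])))
  where
  m²+m≡m[1+m] : m ℕ.* m ℕ.+ m ≡ m ℕ.* suc m
  m²+m≡m[1+m] = trans (ℕ.+-comm (m ℕ.* m) m) (sym (ℕ.*-suc m m))

generator-exists : ∀ {a b} → a > + 0 → a ℤ∣.∣ b * b + + 1 → Generator a b
generator-exists {+ 0} (+<+ ())
generator-exists { -[1+ _ ]} ()
generator-exists {+[1+ m ]} {b} _ = <-rec GeneratorAt descent m b
  where
  GeneratorAt : ℕ → Set
  GeneratorAt m = ∀ b → +[1+ m ] ℤ∣.∣ b * b + + 1 → Generator +[1+ m ] b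

  descent : ∀ m → (∀ {c} → c ℕ.< m → GeneratorAt c) → GeneratorAt m
  descent zero _ b _ = generator-one b
  descent m@(suc _) rec b a∣b²+1 = subst (Generator a) (sym b≡r+ka) (generator-shift k (reduced ℕ∣r²+1))
    where
    a : ℤ
    a = +[1+ m ]
    r : ℕ
    r = b ℤ/.% a
    k : ℤ
    k = b ℤ/./ a
    b≡r+ka : b ≡ + r + k * a
    b≡r+ka = ℤ/.a≡a%n+[a/n]*n b a
    a∣r²+1 : a ℤ∣.∣ + r * + r + + 1
    a∣r²+1 = ∣[x+ka]²+1⇒∣x²+1 {x = + r} k (subst (λ x → a ℤ∣.∣ x * x + + 1) b≡r+ka a∣b²+1)
    ℕ∣r²+1 : suc m ℕ.∣ r ℕ.* r ℕ.+ 1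
    ℕ∣r²+1 = subst (λ x → suc m ℕ.∣ ∣ x + + 1 ∣) (sym (ℤ.pos-* r r)) (ℤ∣.∣⇒∣ᵤ a∣r²+1)
    reduced : suc m ℕ.∣ r ℕ.* r ℕ.+ 1 → Generator a (+ r)
    reduced (ℕ.divides zero r²+1≡0) = ⊥-elim (ℕ.m+1+n≢0 (r ℕ.* r) r²+1≡0)
    reduced (ℕ.divides (suc c) r²+1≡[1+c][1+m]) = generator-descent r²+1≡[1+c]a (rec c<m (+ r) [1+c]∣r²+1)
      where
      c<m : c ℕ.< m
      c<m = cofactor≤ (ℕ.s≤s ℕ.z≤n) (ℕ.s≤s⁻¹ (ℤ/.n%d<d b a)) r²+1≡[1+c][1+m]
      r²+1≡[1+c]a : + r * + r + + 1 ≡ +[1+ c ] * a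
      r²+1≡[1+c]a = begin
        + r * + r + + 1         ≡⟨ cong (_+ + 1) (ℤ.pos-* r r) ⟨
        + (r ℕ.* r ℕ.+ 1)       ≡⟨ cong +_ r²+1≡[1+c][1+m] ⟩
        + (suc c ℕ.* suc m)     ≡⟨ ℤ.pos-* (suc c) (suc m) ⟩
        +[1+ c ] * a            ∎
      [1+c]∣r²+1 : +[1+ c ] ℤ∣.∣ + r * + r + + 1
      [1+c]∣r²+1 = ℤ∣.divides a (trans r²+1≡[1+c]a (ℤ.*-comm +[1+ c ] a))

EvenOdd : ∀ {a b} → Generator a b → Set
EvenOdd G = parity (Generator.p G) ≡ 0ℙ × parity (Generator.q G) ≡ 1ℙ

even-odd-generator : ∀ {a b} → a ℤ∣.∣ b * b + + 1 → parity a ≡ 1ℙ → Generator a b → Σ (Generator a b) EvenOdd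
even-odd-generator {a} {b} a∣b²+1 a-odd G = [ G ,_ , rotate ]′ (odd-sum-of-squares p q (trans (cong parity norm) a-odd))
  where
  open Generator G
  rotate : parity p ≡ 1ℙ × parity q ≡ 0ℙ → Σ (Generator a b) EvenOdd
  rotate (p-odd , q-even) =
    let iG , p≡-q , q≡p = generator-mul-i a∣b²+1 G
    in iG , trans (cong parity p≡-q) (trans (parity-neg q) q-even) , trans (cong parity q≡p) p-odd

-- a (x + y i) = π ω, where π = p + q i and ω = (u a - v b) + v i is the conjugate of u a - v (b + i).
quotient-by-generator : ∀ {a b} → a ℤ∣.∣ b * b + + 1 → (G : Generator a b) → ∀ u v →
  let open Generator G in
  ∃[ x ] ∃[ y ] (x * a ≡ p * (u * a - v * b) - q * v × y * a ≡ p * v + q * (u * a - v * b))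
quotient-by-generator {a} {b} (ℤ∣.divides s b²+1≡sa) record { q = q ; t = t } u v =
  u * (b * q + t * a) - v * (q * s + b * t) , u * q + v * t , x-scaled , y-scaled
  where
  y-scaled : (u * q + v * t) * a ≡ (b * q + t * a) * v + q * (u * a - v * b)
  y-scaled = solve (a ∷ b ∷ q ∷ t ∷ u ∷ v ∷ [])
  x-scaled : (u * (b * q + t * a) - v * (q * s + b * t)) * a ≡ (b * q + t * a) * (u * a - v * b) - q * v
  x-scaled = begin
    (u * (b * q + t * a) - v * (q * s + b * t)) * a
      ≡⟨ solve (a ∷ b ∷ q ∷ s ∷ t ∷ u ∷ v ∷ []) ⟩
    (b * q + t * a) * (u * a - v * b) - q * v + q * v * (b * b + + 1) - q * v * (s * a)
      ≡⟨ cong (λ m → (b * q + t * a) * (u * a - v * b) - q * v + q * v * m - q * v * (s * a)) b²+1≡sa ⟩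
    (b * q + t * a) * (u * a - v * b) - q * v + q * v * (s * a) - q * v * (s * a)
      ≡⟨ solve (a ∷ b ∷ q ∷ s ∷ t ∷ u ∷ v ∷ []) ⟩
    (b * q + t * a) * (u * a - v * b) - q * v ∎

-- ω = π̄ (x + y i).
product-with-generator : ∀ {a b} → a ℤ∣.∣ b * b + + 1 → (G : Generator a b) → ∀ x y →
  let open Generator G in
  ∃[ u ] ∃[ v ] (u * a - v * b ≡ p * x + q * y × v ≡ p * y - q * x)
product-with-generator {a} {b} (ℤ∣.divides s b²+1≡sa) record { q = q ; t = t } x y =
  t * x + y * (q * s + b * t) , (b * q + t * a) * y - q * x , ω-real , refl
  where
  ω-real : (t * x + y * (q * s + b * t)) * a - ((b * q + t * a) * y - q * x) * b ≡ (b * q + t * a) * x + q * y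
  ω-real = begin
    (t * x + y * (q * s + b * t)) * a - ((b * q + t * a) * y - q * x) * b
      ≡⟨ solve (a ∷ b ∷ q ∷ s ∷ t ∷ x ∷ y ∷ []) ⟩
    (b * q + t * a) * x + q * y + q * y * (s * a) - q * y * (b * b + + 1)
      ≡⟨ cong (λ m → (b * q + t * a) * x + q * y + q * y * (s * a) - q * y * m) b²+1≡sa ⟩
    (b * q + t * a) * x + q * y + q * y * (s * a) - q * y * (s * a)
      ≡⟨ solve (a ∷ b ∷ q ∷ s ∷ t ∷ x ∷ y ∷ []) ⟩
    (b * q + t * a) * x + q * y ∎

norm-mul : ∀ p q x y → (p * p + q * q) * (x * x + y * y) ≡
  (p * x - q * y) * (p * x - q * y) + (p * y + q * x) * (p * y + q * x)
norm-mul = solve-∀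

norm-mul-conj : ∀ p q x y → (p * p + q * q) * (x * x + y * y) ≡
  (p * x + q * y) * (p * x + q * y) + (p * y - q * x) * (p * y - q * x)
norm-mul-conj = solve-∀

module Correspondence {a b : ℤ} (a∣b²+1 : a ℤ∣.∣ b * b + + 1) (G : Generator a b)
  (p-even : parity (Generator.p G) ≡ 0ℙ) (q-odd : parity (Generator.q G) ≡ 1ℙ) where

  open Generator G

  a-odd : parity a ≡ 1ℙ
  a-odd = begin
    parity a               ≡⟨ cong parity norm ⟨
    parity (p * p + q * q) ≡⟨ parity-sum-of-squares p q ⟩
    parity p ℙ.+ parity q  ≡⟨ cong₂ ℙ._+_ p-even q-odd ⟩
    1ℙ                     ∎

  instance
    a-nonZero : NonZero a
    a-nonZero = ≢-nonZero {a} λ a≡0 → 0ℙ≢1ℙ (trans (cong parity (sym a≡0)) a-odd)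
      where
      0ℙ≢1ℙ : 0ℙ ≢ 1ℙ
      0ℙ≢1ℙ ()

  parity-p* : ∀ x → parity (p * x) ≡ 0ℙ
  parity-p* x = trans (parity-* p x) (cong (ℙ._* parity x) p-even)

  parity-q* : ∀ y → parity (q * y) ≡ parity y
  parity-q* y = trans (parity-* q y) (cong (ℙ._* parity y) q-odd)

  parity-p*x+q*y : ∀ x y → parity (p * x + q * y) ≡ parity y
  parity-p*x+q*y x y = trans (parity-+ (p * x) (q * y)) (cong₂ ℙ._+_ (parity-p* x) (parity-q* y))

  parity-p*x-q*y : ∀ x y → parity (p * x - q * y) ≡ parity y
  parity-p*x-q*y x y = trans (parity-- (p * x) (q * y)) (cong₂ ℙ._+_ (parity-p* x) (parity-q* y))

  parity-ω : ∀ u v → parity (u * a - v * b) ≡ parity u ℙ.+ (parity v ℙ.* parity b)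
  parity-ω u v = trans (parity-- (u * a) (v * b)) (cong₂ ℙ._+_ (parity-*-odd a-odd u) (parity-* v b))

  module _ (ε η η′ ε′ : ℤ) (η′≈η : parity η′ ≡ parity η)
           (ε′≈ε+ηb : parity ε′ ≡ parity ε ℙ.+ (parity η ℙ.* parity b)) where

    quotient∈T : ∀ {n} u v x y → u ≡ ε [mod + 2 ] → v ≡ η [mod + 2 ] → a * n ≡ normS a b u v →
      x * a ≡ p * (u * a - v * b) - q * v → y * a ≡ p * v + q * (u * a - v * b) → T η′ ε′ n
    quotient∈T {n} u v x y u≡ε v≡η an≡N xa≡ ya≡ = x , y , x≡η′ , y≡ε′ , n≡x²+y²
      where
      A : ℤ
      A = u * a - v * b
      x≡η′ : x ≡ η′ [mod + 2 ]
      x≡η′ = Equivalence.from (≡[mod2]⇔parity≡ x η′) (begin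
        parity x               ≡⟨ parity-*-odd a-odd x ⟨
        parity (x * a)         ≡⟨ cong parity xa≡ ⟩
        parity (p * A - q * v) ≡⟨ parity-p*x-q*y A v ⟩
        parity v               ≡⟨ Equivalence.to (≡[mod2]⇔parity≡ v η) v≡η ⟩
        parity η               ≡⟨ η′≈η ⟨
        parity η′              ∎)
      y≡ε′ : y ≡ ε′ [mod + 2 ]
      y≡ε′ = Equivalence.from (≡[mod2]⇔parity≡ y ε′) (begin
        parity y                              ≡⟨ parity-*-odd a-odd y ⟨
        parity (y * a)                        ≡⟨ cong parity ya≡ ⟩
        parity (p * v + q * A)                ≡⟨ parity-p*x+q*y v A ⟩
        parity A                              ≡⟨ parity-ω u v ⟩
        parity u ℙ.+ (parity v ℙ.* parity b)  ≡⟨ cong₂ (λ π κ → π ℙ.+ (κ ℙ.* parity b))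
                                                   (Equivalence.to (≡[mod2]⇔parity≡ u ε) u≡ε)
                                                   (Equivalence.to (≡[mod2]⇔parity≡ v η) v≡η) ⟩
        parity ε ℙ.+ (parity η ℙ.* parity b)  ≡⟨ ε′≈ε+ηb ⟨
        parity ε′                             ∎)
      a²[x²+y²]≡a²n : a * (a * (x * x + y * y)) ≡ a * (a * n)
      a²[x²+y²]≡a²n = begin
        a * (a * (x * x + y * y))                             ≡⟨ solve (a ∷ x ∷ y ∷ []) ⟩
        x * a * (x * a) + y * a * (y * a)                     ≡⟨ cong₂ (λ X Y → X * X + Y * Y) xa≡ ya≡ ⟩
        (p * A - q * v) * (p * A - q * v) + (p * v + q * A) * (p * v + q * A) ≡⟨ norm-mul p q A v ⟨
        (p * p + q * q) * (A * A + v * v)                     ≡⟨ cong₂ _*_ norm (sym an≡N) ⟩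
        a * (a * n)                                           ∎
      n≡x²+y² : n ≡ x * x + y * y
      n≡x²+y² = sym (ℤ.*-cancelˡ-≡ a _ _ (ℤ.*-cancelˡ-≡ a _ _ a²[x²+y²]≡a²n))

    product∈S : ∀ {n} x y u v → x ≡ η′ [mod + 2 ] → y ≡ ε′ [mod + 2 ] → n ≡ x * x + y * y →
      u * a - v * b ≡ p * x + q * y → v ≡ p * y - q * x → S a b ε η n
    product∈S {n} x y u v x≡η′ y≡ε′ n≡x²+y² A≡ v≡ = u , v , u≡ε , v≡η , an≡N
      where
      A : ℤ
      A = u * a - v * b
      r : Parity
      r = parity η ℙ.* parity b
      v-parity : parity v ≡ parity η
      v-parity = begin
        parity v               ≡⟨ cong parity v≡ ⟩
        parity (p * y - q * x) ≡⟨ parity-p*x-q*y y x ⟩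
        parity x               ≡⟨ Equivalence.to (≡[mod2]⇔parity≡ x η′) x≡η′ ⟩
        parity η′              ≡⟨ η′≈η ⟩
        parity η               ∎
      v≡η : v ≡ η [mod + 2 ]
      v≡η = Equivalence.from (≡[mod2]⇔parity≡ v η) v-parity
      u≡ε : u ≡ ε [mod + 2 ]
      u≡ε = Equivalence.from (≡[mod2]⇔parity≡ u ε) (begin
        parity u             ≡⟨ p+q+q≡p (parity u) r ⟨
        parity u ℙ.+ r ℙ.+ r ≡⟨ cong (ℙ._+ r) (trans (parity-ω u v) (cong (λ κ → parity u ℙ.+ (κ ℙ.* parity b)) v-parity)) ⟨
        parity A ℙ.+ r       ≡⟨ cong (ℙ._+ r) (trans (cong parity A≡) (parity-p*x+q*y x y)) ⟩
        parity y ℙ.+ r       ≡⟨ cong (ℙ._+ r) (trans (Equivalence.to (≡[mod2]⇔parity≡ y ε′) y≡ε′) ε′≈ε+ηb) ⟩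
        parity ε ℙ.+ r ℙ.+ r ≡⟨ p+q+q≡p (parity ε) r ⟩
        parity ε             ∎)
      an≡N : a * n ≡ normS a b u v
      an≡N = begin
        a * n                                                  ≡⟨ cong (a *_) n≡x²+y² ⟩
        a * (x * x + y * y)                                    ≡⟨ cong (_* (x * x + y * y)) norm ⟨
        (p * p + q * q) * (x * x + y * y)                      ≡⟨ norm-mul-conj p q x y ⟩
        (p * x + q * y) * (p * x + q * y) + (p * y - q * x) * (p * y - q * x) ≡⟨ cong₂ (λ X Y → X * X + Y * Y) A≡ v≡ ⟨
        normS a b u v                                          ∎

    S⊆T : ∀ {n} → S a b ε η n → T η′ ε′ n
    S⊆T (u , v , u≡ε , v≡η , an≡N) =
      let x , y , xa≡ , ya≡ = quotient-by-generator a∣b²+1 G u v in quotient∈T u v x y u≡ε v≡η an≡N xa≡ ya≡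

    T⊆S : ∀ {n} → T η′ ε′ n → S a b ε η n
    T⊆S (x , y , x≡η′ , y≡ε′ , n≡x²+y²) =
      let u , v , A≡ , v≡ = product-with-generator a∣b²+1 G x y in product∈S x y u v x≡η′ y≡ε′ n≡x²+y² A≡ v≡

    S≐T : S a b ε η ≐ T η′ ε′
    S≐T n = mk⇔ S⊆T T⊆S

S≐T-by-parity : ∀ {a b} → a > + 0 → parity a ≡ 1ℙ → a ℤ∣.∣ b * b + + 1 →
  ∀ ε η η′ ε′ → parity η′ ≡ parity η → parity ε′ ≡ parity ε ℙ.+ (parity η ℙ.* parity b) →
  S a b ε η ≐ T η′ ε′
S≐T-by-parity a>0 a-odd a∣b²+1 with even-odd-generator a∣b²+1 a-odd (generator-exists a>0 a∣b²+1)
... | G , p-even , q-odd = Correspondence.S≐T a∣b²+1 G p-even q-odd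

lemma5p3 : (a b : ℤ) → a > + 0 → a ≡ + 1 [mod + 4 ] → a ∣ (b * b + + 1) →
  (¬ (+ 2 ∣ b) →
    (S a b (+ 0) (+ 0) ≐ T (+ 0) (+ 0)) × (S a b (+ 1) (+ 0) ≐ T (+ 0) (+ 1)) ×
    (S a b (+ 0) (+ 1) ≐ T (+ 1) (+ 1)) × (S a b (+ 1) (+ 1) ≐ T (+ 1) (+ 0))) ×
  (+ 2 ∣ b →
    (S a b (+ 0) (+ 0) ≐ T (+ 0) (+ 0)) × (S a b (+ 1) (+ 0) ≐ T (+ 0) (+ 1)) ×
    (S a b (+ 0) (+ 1) ≐ T (+ 1) (+ 0)) × (S a b (+ 1) (+ 1) ≐ T (+ 1) (+ 1)))
lemma5p3 a b a>0 a≡1[mod4] a∣b²+1 =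
  (λ 2∤b → let b-odd = ¬2∣⇒parity≡1ℙ b 2∤b in
    S≐T (+ 0) (+ 0) (+ 0) (+ 0) refl refl , S≐T (+ 1) (+ 0) (+ 0) (+ 1) refl refl ,
    S≐T (+ 0) (+ 1) (+ 1) (+ 1) refl (sym b-odd) , S≐T (+ 1) (+ 1) (+ 1) (+ 0) refl (cong ℙ._⁻¹ (sym b-odd))) ,
  (λ 2∣b → let b-even = Equivalence.to (2∣⇔parity≡0ℙ {∣ b ∣}) 2∣b in
    S≐T (+ 0) (+ 0) (+ 0) (+ 0) refl refl , S≐T (+ 1) (+ 0) (+ 0) (+ 1) refl refl ,
    S≐T (+ 0) (+ 1) (+ 1) (+ 0) refl (sym b-even) , S≐T (+ 1) (+ 1) (+ 1) (+ 1) refl (cong ℙ._⁻¹ (sym b-even)))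
  where
  S≐T : ∀ ε η η′ ε′ → parity η′ ≡ parity η → parity ε′ ≡ parity ε ℙ.+ (parity η ℙ.* parity b) →
    S a b ε η ≐ T η′ ε′
  S≐T = S≐T-by-parity a>0 (≡1[mod4]⇒parity≡1ℙ a a≡1[mod4]) (ℤ∣.∣ᵤ⇒∣ a∣b²+1)
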